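{- Let $G$ be an $n$-vertex graph whose complement $\overline{G}$ is a disjoint union of blowups of cliques and isolated vertices. Then $\operatorname{rank}(A_G+I)\cdot\omega(G)\ge n$.
   Context: All graphs are finite, simple and undirected; $A_G$ is the adjacency matrix, $I$ the identity matrix, rank over $\mathbb{R}$, $\omega(G)$ the clique number. A blowup of a graph $H$ with weights $w:V(H)\to\mathbb{Z}_{\ge1}$ is obtained by replacing each vertex $i$ by an independent set of size $w(i)$ and each edge by a complete bipartite graph between the corresponding independent sets. -}

module Defs where

open import Data.Nat using (ℕ; zero; suc)
open import Data.Fin using (Fin; zero; suc; _≟_)
open import Data.Bool using (Bool; true; false; if_then_else_)
open import Data.Maybe using (Maybe; just; nothing)
open import Data.Product using (_×_; _,_; Σ; ∃; ∃-syntax)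
open import Data.Rational using (ℚ; 0ℚ; 1ℚ; _+_; _*_)
open import Relation.Nullary using (¬_; does)
open import Relation.Binary.PropositionalEquality using (_≡_; _≢_)
open import Function.Bundles using (_⇔_)
open import Data.Empty using (⊥)
open import Function.Definitions using (Injective)

record Graph (n : ℕ) : Set where
  field
    adj   : Fin n → Fin n → Bool
    sym   : ∀ u v → adj u v ≡ adj v u
    irrefl : ∀ v → adj v v ≡ false
open Graph public

Σℚ : (k : ℕ) → (Fin k → ℚ) → ℚ
Σℚ zero    f = 0ℚ
Σℚ (suc k) f = f zero + Σℚ k (λ i → f (suc i))

Matrix : ℕ → Set
Matrix n = Fin n → Fin n → ℚ

adjPlusId : ∀ {n} → Graph n → Matrix n
adjPlusId G i j =
  if does (i ≟ j) then 1ℚ else (if adj G i j then 1ℚ else 0ℚ)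

RowsIndependent : ∀ {n k} → Matrix n → (Fin k → Fin n) → Set
RowsIndependent {n} {k} M f =
  (c : Fin k → ℚ) →
  (∀ j → Σℚ k (λ i → c i * M (f i) j) ≡ 0ℚ) →
  ∀ i → c i ≡ 0ℚ

IsRank : ∀ {n} → Matrix n → ℕ → Set
IsRank {n} M r =
  (Σ (Fin r → Fin n) λ f → RowsIndependent M f) ×
  ((g : Fin (suc r) → Fin n) → ¬ RowsIndependent M g)

IsClique : ∀ {n k} → Graph n → (Fin k → Fin n) → Set
IsClique {n} {k} G f = Injective _≡_ _≡_ f × (∀ i j → i ≢ j → adj G (f i) (f j) ≡ true)

IsCliqueNumber : ∀ {n} → Graph n → ℕ → Set
IsCliqueNumber {n} G w =
  (Σ (Fin w → Fin n) λ f → IsClique G f) ×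
  ((g : Fin (suc w) → Fin n) → ¬ IsClique G g)

-- The complement of G is a disjoint union of blowups of cliques and isolated
-- vertices: each vertex is either isolated in the complement (label nothing) or
-- labelled by (component, part); two distinct vertices are adjacent in the
-- complement iff they lie in the same component but in different parts.
SameCompDiffPart : Maybe (ℕ × ℕ) → Maybe (ℕ × ℕ) → Set
SameCompDiffPart (just (c , p)) (just (c' , p')) = (c ≡ c') × (p ≢ p')
SameCompDiffPart _ _ = ⊥

ComplementIsUnionOfCliqueBlowups : ∀ {n} → Graph n → Set
ComplementIsUnionOfCliqueBlowups {n} G =
  Σ (Fin n → Maybe (ℕ × ℕ)) λ φ → (∀ (u v : Fin n) → u ≢ v →
            (adj G u v ≡ false) ⇔ SameCompDiffPart (φ u) (φ v))

{-# OPTIONS --safe #-}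
module Submission where

-- An independent set of G indexes rows of A_G + I containing an identity submatrix, so
-- α(G) ≤ rank(A_G + I). Numbering the parts occurring in each
-- component 0, 1, 2, … splits V(G) into cliques (the j-th parts of all components; vertices
-- isolated in the complement join class 0), and there are at most α(G) of them, because
-- parts 0, …, j of one component contain an independent set of size j + 1. Finally, a
-- covering of n vertices by t cliques gives n ≤ t · ω(G): coding a vertex by its clique and
-- its position inside it is injective.

open import Defs hiding (sym)
open import Data.Nat using (ℕ; _≤_; _*_)
open import Data.Nat.Base using (zero; suc; _<_; z≤n; s≤s)
import Data.Nat.Properties as ℕ
open import Data.Nat.Properties
  using (≤-refl; ≤-trans; n≤1+n; n<1+n; m<n⇒m<1+n; m≤n⇒m<n∨m≡n; <⇒≢; ≮⇒≥;
         <-cmp; <-irrefl)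
open import Data.Fin.Base using (Fin; zero; suc; toℕ; fromℕ<; combine)
open import Data.Fin.Properties
  using (_≟_; suc-injective; any?; toℕ-injective; fromℕ<-injective; inject≤-injective;
         combine-injective; injective⇒≤)
open import Data.Vec.Functional using (_∷_)
open import Data.Bool.Base using (Bool; true; false; if_then_else_)
open import Data.Bool.Properties using (¬-not)
open import Data.Maybe.Base using (Maybe; just; nothing; maybe) renaming (map to mapMaybe)
open import Data.Maybe.Properties using (just-injective) renaming (≡-dec to ≡-dec-Maybe)
open import Data.Product.Base using (Σ; ∃; _×_; _,_; proj₁; proj₂)
open import Data.Sum.Base using (inj₁; inj₂)
open import Data.Rational.Base using (ℚ; 0ℚ; 1ℚ; _+_) renaming (_*_ to _*ℚ_)
import Data.Rational.Properties as ℚ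
open import Function.Base using (_∘_)
open import Function.Bundles using (_⇔_; mk⇔; Equivalence)
import Function.Properties.Equivalence as ⇔
open import Function.Definitions using (Injective)
open import Relation.Binary.Definitions using (DecidableEquality; tri<; tri≈; tri>)
open import Relation.Binary.PropositionalEquality
  using (_≡_; _≢_; refl; sym; trans; cong; cong₂; module ≡-Reasoning)
open import Relation.Nullary using (¬_; does; yes; no; contradiction)
open import Relation.Nullary.Decidable using (_×-dec_; dec-true; dec-false)
open import Relation.Unary using (Pred; Decidable)

∷-injective : ∀ {a} {A : Set a} {n} {x : A} {f : Fin n → A} →
              (∀ i → f i ≢ x) → Injective _≡_ _≡_ f → Injective _≡_ _≡_ (x ∷ f)
∷-injective fresh f-inj {zero}  {zero}  _  = refl
∷-injective fresh f-inj {zero}  {suc j} eq = contradiction (sym eq) (fresh j)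
∷-injective fresh f-inj {suc i} {zero}  eq = contradiction eq (fresh i)
∷-injective fresh f-inj {suc i} {suc j} eq = cong suc (f-inj eq)

module _ {p} {P : Pred ℕ p} (P? : Decidable P) where

  countBelow : ℕ → ℕ
  countBelow zero    = zero
  countBelow (suc k) = if does (P? k) then suc (countBelow k) else countBelow k

  countBelow-≤-suc : ∀ k → countBelow k ≤ countBelow (suc k)
  countBelow-≤-suc k with P? k
  ... | yes _ = n≤1+n _
  ... | no  _ = ≤-refl

  countBelow-mono : ∀ {j k} → j ≤ k → countBelow j ≤ countBelow k
  countBelow-mono {k = zero}  z≤n = ≤-refl
  countBelow-mono {k = suc k} j≤1+k with m≤n⇒m<n∨m≡n j≤1+k
  ... | inj₁ (s≤s j≤k) = ≤-trans (countBelow-mono j≤k) (countBelow-≤-suc k)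
  ... | inj₂ refl      = ≤-refl

  countBelow-strict : ∀ {j k} → P j → j < k → countBelow j < countBelow k
  countBelow-strict {j} Pj j<k with P? j | countBelow-mono j<k
  ... | yes _  | 1+j≤k = 1+j≤k
  ... | no ¬Pj | _     = contradiction Pj ¬Pj

  enumerateBelow : ∀ k → Fin (countBelow k) → ℕ
  enumerateBelow (suc k) with P? k
  ... | yes _ = k ∷ enumerateBelow k
  ... | no  _ = enumerateBelow k

  enumerateBelow-sat : ∀ k i → P (enumerateBelow k i)
  enumerateBelow-sat (suc k) i with P? k
  enumerateBelow-sat (suc k) zero    | yes Pk = Pk
  enumerateBelow-sat (suc k) (suc i) | yes _  = enumerateBelow-sat k i
  enumerateBelow-sat (suc k) i       | no  _  = enumerateBelow-sat k i

  enumerateBelow-< : ∀ k i → enumerateBelow k i < k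
  enumerateBelow-< (suc k) i with P? k
  enumerateBelow-< (suc k) zero    | yes _ = n<1+n k
  enumerateBelow-< (suc k) (suc i) | yes _ = m<n⇒m<1+n (enumerateBelow-< k i)
  enumerateBelow-< (suc k) i       | no  _ = m<n⇒m<1+n (enumerateBelow-< k i)

  enumerateBelow-injective : ∀ k → Injective _≡_ _≡_ (enumerateBelow k)
  enumerateBelow-injective (suc k) with P? k
  ... | yes _ = ∷-injective (λ i → <⇒≢ (enumerateBelow-< k i)) (enumerateBelow-injective k)
  ... | no  _ = enumerateBelow-injective k

module Ranking {A : Set} (_≟ᴬ_ : DecidableEquality A) {n}
               (group : Fin n → A) (key : Fin n → ℕ) where

  Occurs : A → ℕ → Set
  Occurs a j = ∃ λ u → group u ≡ a × key u ≡ j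

  occurs? : ∀ a → Decidable (Occurs a)
  occurs? a j = any? λ u → (group u ≟ᴬ a) ×-dec (key u ℕ.≟ j)

  rank : Fin n → ℕ
  rank v = countBelow (occurs? (group v)) (key v)

  rank-strict : ∀ {u v} → group u ≡ group v → key u < key v → rank u < rank v
  rank-strict {u} {v} same lt rewrite same =
    countBelow-strict (occurs? (group v)) (u , same , refl) lt

  rank-injective : ∀ {u v} → group u ≡ group v → rank u ≡ rank v → key u ≡ key v
  rank-injective {u} {v} same eq with <-cmp (key u) (key v)
  ... | tri< lt _ _  = contradiction (rank-strict same lt) (<-irrefl eq)
  ... | tri≈ _ keq _ = keq
  ... | tri> _ _ gt  = contradiction (rank-strict (sym same) gt) (<-irrefl (sym eq))

  smallerKeys : (v : Fin n) → Fin (rank v) → ℕ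
  smallerKeys v = enumerateBelow (occurs? (group v)) (key v)

  smallerKeys-occur : ∀ v i → Occurs (group v) (smallerKeys v i)
  smallerKeys-occur v = enumerateBelow-sat (occurs? (group v)) (key v)

  representatives : (v : Fin n) → Fin (suc (rank v)) → Fin n
  representatives v = v ∷ proj₁ ∘ smallerKeys-occur v

  representatives-group : ∀ v i → group (representatives v i) ≡ group v
  representatives-group v zero    = refl
  representatives-group v (suc i) = proj₁ (proj₂ (smallerKeys-occur v i))

  representatives-sameGroup : ∀ v i j →
                              group (representatives v i) ≡ group (representatives v j)
  representatives-sameGroup v i j =
    trans (representatives-group v i) (sym (representatives-group v j))

  representatives-key : ∀ v i → key (representatives v i) ≡ (key v ∷ smallerKeys v) i
  representatives-key v zero    = refl
  representatives-key v (suc i) = proj₂ (proj₂ (smallerKeys-occur v i))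

  representatives-key-injective : ∀ v → Injective _≡_ _≡_ (key ∘ representatives v)
  representatives-key-injective v {i} {j} eq =
    keys-injective (trans (sym (representatives-key v i)) (trans eq (representatives-key v j)))
    where
    keys-injective : Injective _≡_ _≡_ (key v ∷ smallerKeys v)
    keys-injective = ∷-injective (λ i → <⇒≢ (enumerateBelow-< _ (key v) i))
                                 (enumerateBelow-injective _ (key v))

  representatives-injective : ∀ v → Injective _≡_ _≡_ (representatives v)
  representatives-injective v eq = representatives-key-injective v (cong key eq)

Σℚ-zero : ∀ k {f : Fin k → ℚ} → (∀ i → f i ≡ 0ℚ) → Σℚ k f ≡ 0ℚ
Σℚ-zero zero    _   = refl
Σℚ-zero (suc k) f≡0 = cong₂ _+_ (f≡0 zero) (Σℚ-zero k (f≡0 ∘ suc))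

Σℚ-single : ∀ k {f : Fin k → ℚ} (j : Fin k) → (∀ i → i ≢ j → f i ≡ 0ℚ) → Σℚ k f ≡ f j
Σℚ-single (suc k) {f} zero    f≡0 = begin
  f zero + Σℚ k (f ∘ suc) ≡⟨ cong (f zero +_) (Σℚ-zero k (λ i → f≡0 (suc i) λ ())) ⟩
  f zero + 0ℚ             ≡⟨ ℚ.+-identityʳ (f zero) ⟩
  f zero                  ∎
  where open ≡-Reasoning
Σℚ-single (suc k) {f} (suc j) f≡0 = begin
  f zero + Σℚ k (f ∘ suc) ≡⟨ cong₂ _+_ (f≡0 zero λ ()) (Σℚ-single k j off-j) ⟩
  0ℚ + f (suc j)          ≡⟨ ℚ.+-identityˡ (f (suc j)) ⟩
  f (suc j)               ∎
  where
  open ≡-Reasoning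
  off-j : ∀ i → i ≢ j → f (suc i) ≡ 0ℚ
  off-j i i≢j = f≡0 (suc i) (i≢j ∘ suc-injective)

IsHomogeneous : ∀ {n k} → Graph n → Bool → (Fin k → Fin n) → Set
IsHomogeneous G b f = Injective _≡_ _≡_ f × (∀ i j → i ≢ j → adj G (f i) (f j) ≡ b)

IsIndependentSet : ∀ {n k} → Graph n → (Fin k → Fin n) → Set
IsIndependentSet G = IsHomogeneous G false

IsCliqueCover : ∀ {n t} → Graph n → (Fin n → Fin t) → Set
IsCliqueCover G cls = ∀ {u v} → u ≢ v → cls u ≡ cls v → adj G u v ≡ true

module _ {n} (G : Graph n) {b : Bool} where

  IsHomogeneous-reindex : ∀ {k m} {f : Fin k → Fin n} {ι : Fin m → Fin k} →
                          Injective _≡_ _≡_ ι → IsHomogeneous G b f → IsHomogeneous G b (f ∘ ι)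
  IsHomogeneous-reindex ι-inj (f-inj , f-hom) =
    ι-inj ∘ f-inj , λ i j i≢j → f-hom _ _ (i≢j ∘ ι-inj)

  IsHomogeneous-size≤ : ∀ {m k} {f : Fin k → Fin n} →
                        (∀ (g : Fin (suc m) → Fin n) → ¬ IsHomogeneous G b g) →
                        IsHomogeneous G b f → k ≤ m
  IsHomogeneous-size≤ none hom = ≮⇒≥ λ m<k →
    none _ (IsHomogeneous-reindex (λ {i} {j} → inject≤-injective m<k m<k i j) hom)

clique-size≤ω : ∀ {n k w} (G : Graph n) {f : Fin k → Fin n} →
                IsCliqueNumber G w → IsClique G f → k ≤ w
clique-size≤ω G (_ , none) = IsHomogeneous-size≤ G none

adjPlusId-diagonal : ∀ {n} (G : Graph n) i → adjPlusId G i i ≡ 1ℚ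
adjPlusId-diagonal G i =
  cong (λ b → if b then 1ℚ else (if adj G i i then 1ℚ else 0ℚ)) (dec-true (i ≟ i) refl)

adjPlusId-nonadjacent : ∀ {n} (G : Graph n) {i j} → i ≢ j → adj G i j ≡ false →
                        adjPlusId G i j ≡ 0ℚ
adjPlusId-nonadjacent G {i} {j} i≢j nonadj =
  cong₂ (λ b c → if b then 1ℚ else (if c then 1ℚ else 0ℚ)) (dec-false (i ≟ j) i≢j) nonadj

independentSet⇒rowsIndependent : ∀ {n k} (G : Graph n) {f : Fin k → Fin n} →
                                 IsIndependentSet G f → RowsIndependent (adjPlusId G) f
independentSet⇒rowsIndependent {k = k} G {f} (f-inj , f-indep) c combination≡0 j = begin
  c j                                           ≡⟨ ℚ.*-identityʳ (c j) ⟨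
  c j *ℚ 1ℚ                                     ≡⟨ cong (c j *ℚ_) (adjPlusId-diagonal G (f j)) ⟨
  c j *ℚ adjPlusId G (f j) (f j)                ≡⟨ Σℚ-single k j off-diagonal ⟨
  Σℚ k (λ i → c i *ℚ adjPlusId G (f i) (f j))   ≡⟨ combination≡0 (f j) ⟩
  0ℚ                                            ∎
  where
  open ≡-Reasoning
  off-diagonal : ∀ i → i ≢ j → c i *ℚ adjPlusId G (f i) (f j) ≡ 0ℚ
  off-diagonal i i≢j = begin
    c i *ℚ adjPlusId G (f i) (f j) ≡⟨ cong (c i *ℚ_) (adjPlusId-nonadjacent G f-i≢f-j (f-indep i j i≢j)) ⟩
    c i *ℚ 0ℚ                      ≡⟨ ℚ.*-zeroʳ (c i) ⟩
    0ℚ                             ∎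
    where
    f-i≢f-j : f i ≢ f j
    f-i≢f-j = i≢j ∘ f-inj

independentSet-size≤rank : ∀ {n k r} (G : Graph n) {f : Fin k → Fin n} →
                           IsRank (adjPlusId G) r → IsIndependentSet G f → k ≤ r
independentSet-size≤rank G (_ , none) =
  IsHomogeneous-size≤ G λ g indep → none g (independentSet⇒rowsIndependent G indep)

cliqueCover-size : ∀ {n t w} (G : Graph n) {cls : Fin n → Fin t} →
                   IsCliqueNumber G w → IsCliqueCover G cls → n ≤ t * w
cliqueCover-size {n} {t} {w} G {cls} cw cover = injective⇒≤ code-injective
  where
  open Ranking _≟_ cls toℕ

  rank<ω : ∀ v → rank v < w
  rank<ω v = clique-size≤ω G cw (representatives-injective v , λ i j i≢j →
    cover (i≢j ∘ representatives-injective v) (representatives-sameGroup v i j))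

  code : Fin n → Fin (t * w)
  code v = combine (cls v) (fromℕ< (rank<ω v))

  code-injective : Injective _≡_ _≡_ code
  code-injective {u} {v} eq with combine-injective (cls u) _ (cls v) _ eq
  ... | same-class , same-rank = toℕ-injective (rank-injective same-class
                                   (fromℕ<-injective _ _ (rank<ω u) (rank<ω v) same-rank))

component : Maybe (ℕ × ℕ) → Maybe ℕ
component = mapMaybe proj₁

-- Vertices isolated in the complement get component nothing and the junk part 0, so all of
-- them have rank 0.
part : Maybe (ℕ × ℕ) → ℕ
part = maybe proj₂ 0

sameCompDiffPart⇔ : ∀ x y →
                    SameCompDiffPart x y ⇔ (component x ≡ component y × part x ≢ part y)
sameCompDiffPart⇔ (just _) (just _) =
  mk⇔ (λ (same , diff) → cong just same , diff) (λ (same , diff) → just-injective same , diff)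
sameCompDiffPart⇔ (just _) nothing  = mk⇔ (λ ()) (λ { (() , _) })
sameCompDiffPart⇔ nothing  (just _) = mk⇔ (λ ()) (λ { (() , _) })
sameCompDiffPart⇔ nothing  nothing  = mk⇔ (λ ()) (λ (_ , 0≢0) → 0≢0 refl)

blowupComplement⇒cliqueCover : ∀ {n r} (G : Graph n) →
                               ComplementIsUnionOfCliqueBlowups G → IsRank (adjPlusId G) r →
                               Σ (Fin n → Fin r) (IsCliqueCover G)
blowupComplement⇒cliqueCover {n} {r} G (φ , nonadjacent⇔sameCompDiffPart) rk = cls , cover
  where
  open Ranking (≡-dec-Maybe ℕ._≟_) (component ∘ φ) (part ∘ φ)

  nonadjacent⇔ : ∀ {u v} → u ≢ v → adj G u v ≡ false ⇔
                 (component (φ u) ≡ component (φ v) × part (φ u) ≢ part (φ v))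
  nonadjacent⇔ {u} {v} u≢v =
    ⇔.trans (nonadjacent⇔sameCompDiffPart u v u≢v) (sameCompDiffPart⇔ (φ u) (φ v))

  rank<r : ∀ v → rank v < r
  rank<r v = independentSet-size≤rank G rk (representatives-injective v , λ i j i≢j →
    Equivalence.from (nonadjacent⇔ (i≢j ∘ representatives-injective v))
      (representatives-sameGroup v i j , i≢j ∘ representatives-key-injective v))

  cls : Fin n → Fin r
  cls v = fromℕ< (rank<r v)

  cover : IsCliqueCover G cls
  cover {u} {v} u≢v same-class = ¬-not λ nonadjacent →
    let same-component , different-part = Equivalence.to (nonadjacent⇔ u≢v) nonadjacent
    in  different-part (rank-injective same-component
                          (fromℕ<-injective _ _ (rank<r u) (rank<r v) same-class))

lemma2p16 : (n : ℕ) (G : Graph n) → ComplementIsUnionOfCliqueBlowups G →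
            (r w : ℕ) → IsRank (adjPlusId G) r → IsCliqueNumber G w →
            n ≤ r * w
lemma2p16 n G blowup r w rk cw =
  cliqueCover-size G cw (proj₂ (blowupComplement⇒cliqueCover G blowup rk))
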